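{- For sufficiently large $n$, any data structure (encoding) built from an array $A[1..n]$ from which the answers to all range minimum and all range maximum queries on $A$ can be recovered must occupy at least $3n - \Theta(\log n)$ bits.
   Context: A range minimum (resp. maximum) query on $A[i..j]$, $1\le i\le j\le n$, returns the index of the minimum (resp. maximum) element of $A[i..j]$. The bound is a worst-case bound over arrays of length $n$, i.e. it concerns the number of bits needed to distinguish all arrays that have different answers to some such query. -}

module Defs where

open import Data.Nat using (ℕ; zero; suc; _+_; _∸_; _<ᵇ_)
open import Data.Bool using (if_then_else_)
open import Data.Fin using (Fin; toℕ)
open import Data.Product using (_×_; _,_)

Array : ℕ → Set
Array n = Fin n → ℕ

-- Extend an array to all of ℕ (value 0 outside the array; never
-- consulted by in-range queries).
ext : ∀ {n} → Array n → ℕ → ℕ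
ext {zero}  A k       = 0
ext {suc n} A zero    = A Fin.zero
  where import Data.Fin as Fin
ext {suc n} A (suc k) = ext {n} (λ i → A (Fin.suc i)) k
  where import Data.Fin as Fin

-- Index of the leftmost minimum of f on [i, i+k].
argminFrom : (ℕ → ℕ) → ℕ → ℕ → ℕ
argminFrom f i zero    = i
argminFrom f i (suc k) =
  let m = argminFrom f i k in
  if f (i + suc k) <ᵇ f m then i + suc k else m

-- Index of the leftmost maximum of f on [i, i+k].
argmaxFrom : (ℕ → ℕ) → ℕ → ℕ → ℕ
argmaxFrom f i zero    = i
argmaxFrom f i (suc k) =
  let m = argmaxFrom f i k in
  if f m <ᵇ f (i + suc k) then i + suc k else m

-- Range minimum query on A[i..j] (meaningful for i ≤ j).
RMinQ : ∀ {n} → Array n → Fin n → Fin n → ℕ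
RMinQ A i j = argminFrom (ext A) (toℕ i) (toℕ j ∸ toℕ i)

-- Range maximum query on A[i..j] (meaningful for i ≤ j).
RMaxQ : ∀ {n} → Array n → Fin n → Fin n → ℕ
RMaxQ A i j = argmaxFrom (ext A) (toℕ i) (toℕ j ∸ toℕ i)

RMinMax : ∀ {n} → Array n → Fin n → Fin n → ℕ × ℕ
RMinMax A i j = RMinQ A i j , RMaxQ A i j

module Submission where

-- Arrays are built left to right. Relative to the current stacks of suffix
-- minima and suffix maxima, the next element either ties with the last one,
-- or rises above exactly the top r + 1 entries of the max stack, or falls below
-- exactly the top r + 1 entries of the min stack. Two different choices are
-- told apart by a query ending at the new position, and since old values are
-- only stretched, never reordered, later elements do not change earlier
-- answers; so distinct choice sequences give arrays with distinct answers.
-- Tracking capped lower bounds (α, β) on the stack lengths, the number of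
-- choice sequences obeys count (ℓ + 1) = transfer (count ℓ), and a table w with
-- 8 w ≤ transfer w gives count ℓ ≥ 8 ^ ℓ · w / max w. Hence more than 2 ^ (3 t)
-- arrays of length 7 + t have pairwise different answers, and by pigeonhole
-- one of them is encoded with at least 3 t bits.

open import Data.Bool using (Bool; true; false; if_then_else_; T; _∧_)
open import Data.Bool.Properties using (T-≡; T-∧; ∧-zeroʳ)
open import Data.Empty using (⊥-elim)
open import Data.Fin as Fin using (Fin; toℕ; fromℕ<; zero; suc; splitAt; _↑ˡ_; _↑ʳ_)
import Data.Fin.Properties as Finₚ
open import Data.List using (List; []; _∷_; length; drop)
open import Data.Nat
open import Data.Nat.Logarithm using (⌊log₂_⌋; ⌊log₂⌋-mono-≤; ⌊log₂[2^n]⌋≡n)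
open import Data.Nat.Properties
open import Data.Product using (Σ; ∃-syntax; _×_; _,_; proj₁; proj₂; map; map₂)
open import Data.Sum using (_⊎_; inj₁; inj₂)
open import Data.Unit using (tt)
open import Function using (Equivalence; _∘_; id)
open import Relation.Binary.Definitions using (tri<; tri≈; tri>)
open import Relation.Binary.PropositionalEquality
open import Relation.Nullary using (¬_; yes; no)

open import Defs

-- Range minima and maxima

<ᵇ≡true⇒< : ∀ {a b} → (a <ᵇ b) ≡ true → a < b
<ᵇ≡true⇒< {a} {b} e = <ᵇ⇒< a b (Equivalence.from T-≡ e)

<ᵇ≡false⇒≥ : ∀ {a b} → (a <ᵇ b) ≡ false → b ≤ a
<ᵇ≡false⇒≥ e = ≮⇒≥ (λ a<b → subst T e (<⇒<ᵇ a<b))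

<⇒<ᵇ≡true : ∀ {a b} → a < b → (a <ᵇ b) ≡ true
<⇒<ᵇ≡true a<b = Equivalence.to T-≡ (<⇒<ᵇ a<b)

≥⇒<ᵇ≡false : ∀ {a b} → b ≤ a → (a <ᵇ b) ≡ false
≥⇒<ᵇ≡false {a} {b} b≤a with a <ᵇ b in e
... | true  = ⊥-elim (<⇒≱ (<ᵇ≡true⇒< e) b≤a)
... | false = refl

argmaxFrom-range : ∀ (f : ℕ → ℕ) i k → i ≤ argmaxFrom f i k × argmaxFrom f i k ≤ i + k
argmaxFrom-range f i zero    = ≤-refl , m≤m+n i 0
argmaxFrom-range f i (suc k) with f (argmaxFrom f i k) <ᵇ f (i + suc k)
... | true  = m≤m+n i (suc k) , ≤-refl
... | false = map₂ (λ m≤i+k → ≤-trans m≤i+k (+-monoʳ-≤ i (n≤1+n k))) (argmaxFrom-range f i k)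

argminFrom-range : ∀ (f : ℕ → ℕ) i k → i ≤ argminFrom f i k × argminFrom f i k ≤ i + k
argminFrom-range f i zero    = ≤-refl , m≤m+n i 0
argminFrom-range f i (suc k) with f (i + suc k) <ᵇ f (argminFrom f i k)
... | true  = m≤m+n i (suc k) , ≤-refl
... | false = map₂ (λ m≤i+k → ≤-trans m≤i+k (+-monoʳ-≤ i (n≤1+n k))) (argminFrom-range f i k)

private
  below-end : ∀ {i j k} → j ≤ i + suc k → j ≢ i + suc k → j ≤ i + k
  below-end {i} {j} {k} j≤ j≢ = ≤-pred (subst (j <_) (+-suc i k) (≤∧≢⇒< j≤ j≢))

argmaxFrom-maximal : ∀ (f : ℕ → ℕ) i k {j} → i ≤ j → j ≤ i + k → f j ≤ f (argmaxFrom f i k)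
argmaxFrom-maximal f i zero {j} i≤j j≤i+0
  rewrite ≤-antisym (subst (j ≤_) (+-identityʳ i) j≤i+0) i≤j = ≤-refl
argmaxFrom-maximal f i (suc k) {j} i≤j j≤ with f (argmaxFrom f i k) <ᵇ f (i + suc k) in e | j ≟ i + suc k
... | true  | yes refl = ≤-refl
... | true  | no j≢   = ≤-trans (argmaxFrom-maximal f i k i≤j (below-end j≤ j≢)) (<⇒≤ (<ᵇ≡true⇒< e))
... | false | yes refl = <ᵇ≡false⇒≥ e
... | false | no j≢   = argmaxFrom-maximal f i k i≤j (below-end j≤ j≢)

argminFrom-minimal : ∀ (f : ℕ → ℕ) i k {j} → i ≤ j → j ≤ i + k → f (argminFrom f i k) ≤ f j
argminFrom-minimal f i zero {j} i≤j j≤i+0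
  rewrite ≤-antisym (subst (j ≤_) (+-identityʳ i) j≤i+0) i≤j = ≤-refl
argminFrom-minimal f i (suc k) {j} i≤j j≤ with f (i + suc k) <ᵇ f (argminFrom f i k) in e | j ≟ i + suc k
... | true  | yes refl = ≤-refl
... | true  | no j≢   = ≤-trans (<⇒≤ (<ᵇ≡true⇒< e)) (argminFrom-minimal f i k i≤j (below-end j≤ j≢))
... | false | yes refl = <ᵇ≡false⇒≥ e
... | false | no j≢   = argminFrom-minimal f i k i≤j (below-end j≤ j≢)

record SameOrderUpTo (n : ℕ) (f g : ℕ → ℕ) : Set where
  constructor sameOrder
  field
    <ᵇ-≡ : ∀ {x y} → x ≤ n → y ≤ n → (f x <ᵇ f y) ≡ (g x <ᵇ g y)
open SameOrderUpTo

sameOrder-mono : ∀ {m n f g} → m ≤ n → SameOrderUpTo n f g → SameOrderUpTo m f g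
sameOrder-mono m≤n same = sameOrder λ x≤m y≤m → <ᵇ-≡ same (≤-trans x≤m m≤n) (≤-trans y≤m m≤n)

sameOrder-trans : ∀ {n f g h} → SameOrderUpTo n f g → SameOrderUpTo n g h → SameOrderUpTo n f h
sameOrder-trans fg gh = sameOrder λ x≤n y≤n → trans (<ᵇ-≡ fg x≤n y≤n) (<ᵇ-≡ gh x≤n y≤n)

argmaxFrom-cong : ∀ {f g} i k → SameOrderUpTo (i + k) f g → argmaxFrom f i k ≡ argmaxFrom g i k
argmaxFrom-cong i zero    same = refl
argmaxFrom-cong {f} {g} i (suc k) same
  rewrite argmaxFrom-cong i k (sameOrder-mono (+-monoʳ-≤ i (n≤1+n k)) same)
        | <ᵇ-≡ same (≤-trans (proj₂ (argmaxFrom-range g i k)) (+-monoʳ-≤ i (n≤1+n k))) ≤-refl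
  = refl

argminFrom-cong : ∀ {f g} i k → SameOrderUpTo (i + k) f g → argminFrom f i k ≡ argminFrom g i k
argminFrom-cong i zero    same = refl
argminFrom-cong {f} {g} i (suc k) same
  rewrite argminFrom-cong i k (sameOrder-mono (+-monoʳ-≤ i (n≤1+n k)) same)
        | <ᵇ-≡ same ≤-refl (≤-trans (proj₂ (argminFrom-range g i k)) (+-monoʳ-≤ i (n≤1+n k)))
  = refl

private
  suc-∸-split : ∀ {p k} → p ≤ k → suc k ∸ p ≡ suc (k ∸ p) × p + suc (k ∸ p) ≡ suc k
  suc-∸-split {p} p≤k = +-∸-assoc 1 p≤k , trans (+-suc p _) (cong suc (m+[n∸m]≡n p≤k))

argmaxFrom-snoc : ∀ (G : ℕ → ℕ) {p k} → p ≤ k →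
                  argmaxFrom G p (suc k ∸ p) ≡
                  (if G (argmaxFrom G p (k ∸ p)) <ᵇ G (suc k) then suc k else argmaxFrom G p (k ∸ p))
argmaxFrom-snoc G p≤k rewrite proj₁ (suc-∸-split p≤k) | proj₂ (suc-∸-split p≤k) = refl

argminFrom-snoc : ∀ (G : ℕ → ℕ) {p k} → p ≤ k →
                  argminFrom G p (suc k ∸ p) ≡
                  (if G (suc k) <ᵇ G (argminFrom G p (k ∸ p)) then suc k else argminFrom G p (k ∸ p))
argminFrom-snoc G p≤k rewrite proj₁ (suc-∸-split p≤k) | proj₂ (suc-∸-split p≤k) = refl

private
  within : ∀ {p j k} → p ≤ k → j ≤ k → j ≤ p + (k ∸ p)
  within {p} {j} p≤k j≤k = subst (j ≤_) (sym (m+[n∸m]≡n p≤k)) j≤k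

  end-≤ : ∀ {p k m} → p ≤ k → m ≤ p + (k ∸ p) → m ≤ k
  end-≤ {p} {k} {m} p≤k = subst (m ≤_) (m+[n∸m]≡n p≤k)

argmaxFrom-snoc-new : ∀ (G : ℕ → ℕ) {p k} → p ≤ k →
                      (∀ {i} → p ≤ i → i ≤ k → G i < G (suc k)) →
                      argmaxFrom G p (suc k ∸ p) ≡ suc k
argmaxFrom-snoc-new G {p} {k} p≤k new with argmaxFrom-range G p (k ∸ p)
... | p≤m , m≤ rewrite argmaxFrom-snoc G p≤k | <⇒<ᵇ≡true (new p≤m (end-≤ p≤k m≤)) = refl

argmaxFrom-snoc-old : ∀ (G : ℕ → ℕ) {p j k} → p ≤ j → j ≤ k → G (suc k) ≤ G j →
                      argmaxFrom G p (suc k ∸ p) ≤ k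
argmaxFrom-snoc-old G {p} {j} {k} p≤j j≤k old
  rewrite argmaxFrom-snoc G (≤-trans p≤j j≤k)
        | ≥⇒<ᵇ≡false (≤-trans old (argmaxFrom-maximal G p (k ∸ p) p≤j (within (≤-trans p≤j j≤k) j≤k)))
  = end-≤ (≤-trans p≤j j≤k) (proj₂ (argmaxFrom-range G p (k ∸ p)))

argminFrom-snoc-new : ∀ (G : ℕ → ℕ) {p k} → p ≤ k →
                      (∀ {i} → p ≤ i → i ≤ k → G (suc k) < G i) →
                      argminFrom G p (suc k ∸ p) ≡ suc k
argminFrom-snoc-new G {p} {k} p≤k new with argminFrom-range G p (k ∸ p)
... | p≤m , m≤ rewrite argminFrom-snoc G p≤k | <⇒<ᵇ≡true (new p≤m (end-≤ p≤k m≤)) = refl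

argminFrom-snoc-old : ∀ (G : ℕ → ℕ) {p j k} → p ≤ j → j ≤ k → G j ≤ G (suc k) →
                      argminFrom G p (suc k ∸ p) ≤ k
argminFrom-snoc-old G {p} {j} {k} p≤j j≤k old
  rewrite argminFrom-snoc G (≤-trans p≤j j≤k)
        | ≥⇒<ᵇ≡false (≤-trans (argminFrom-minimal G p (k ∸ p) p≤j (within (≤-trans p≤j j≤k) j≤k)) old)
  = end-≤ (≤-trans p≤j j≤k) (proj₂ (argminFrom-range G p (k ∸ p)))

minMaxOn : (ℕ → ℕ) → ℕ → ℕ → ℕ × ℕ
minMaxOn G i j = argminFrom G i (j ∸ i) , argmaxFrom G i (j ∸ i)

record AgreeUpTo (n : ℕ) (G G′ : ℕ → ℕ) : Set where
  constructor agree
  field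
    minMaxOn-≡ : ∀ {i j} → i ≤ j → j ≤ n → minMaxOn G i j ≡ minMaxOn G′ i j
open AgreeUpTo

minMaxOn-cong : ∀ {f g i j} → i ≤ j → SameOrderUpTo j f g → minMaxOn f i j ≡ minMaxOn g i j
minMaxOn-cong {f} {g} {i} {j} i≤j same =
  cong₂ _,_ (argminFrom-cong i (j ∸ i) same′) (argmaxFrom-cong i (j ∸ i) same′)
  where
    same′ : SameOrderUpTo (i + (j ∸ i)) f g
    same′ = sameOrder-mono (≤-reflexive (m+[n∸m]≡n i≤j)) same

sameOrder⇒agree : ∀ {n f g} → SameOrderUpTo n f g → AgreeUpTo n f g
sameOrder⇒agree same = agree λ i≤j j≤n → minMaxOn-cong i≤j (sameOrder-mono j≤n same)

agree-sym : ∀ {n G G′} → AgreeUpTo n G G′ → AgreeUpTo n G′ G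
agree-sym a = agree λ i≤j j≤n → sym (minMaxOn-≡ a i≤j j≤n)

agree-trans : ∀ {n G G′ G′'} → AgreeUpTo n G G′ → AgreeUpTo n G′ G′' → AgreeUpTo n G G′'
agree-trans a b = agree λ i≤j j≤n → trans (minMaxOn-≡ a i≤j j≤n) (minMaxOn-≡ b i≤j j≤n)

agree-mono : ∀ {m n G G′} → m ≤ n → AgreeUpTo n G G′ → AgreeUpTo m G G′
agree-mono m≤n a = agree λ i≤j j≤m → minMaxOn-≡ a i≤j (≤-trans j≤m m≤n)

disagree-sym : ∀ {n G G′} → ¬ AgreeUpTo n G G′ → ¬ AgreeUpTo n G′ G
disagree-sym apart a = apart (agree-sym a)

separatedByMax : ∀ {G G′ : ℕ → ℕ} {p j k} → p ≤ j → j ≤ k → G (suc k) ≤ G j →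
                 (∀ {i} → p ≤ i → i ≤ k → G′ i < G′ (suc k)) → ¬ AgreeUpTo (suc k) G G′
separatedByMax {G} {G′} {k = k} p≤j j≤k old new a =
  1+n≰n (subst (_≤ k) (trans (cong proj₂ (minMaxOn-≡ a (m≤n⇒m≤1+n p≤k) ≤-refl))
                             (argmaxFrom-snoc-new G′ p≤k new))
                      (argmaxFrom-snoc-old G p≤j j≤k old))
  where
    p≤k : _ ≤ k
    p≤k = ≤-trans p≤j j≤k

separatedByMin : ∀ {G G′ : ℕ → ℕ} {p j k} → p ≤ j → j ≤ k → G j ≤ G (suc k) →
                 (∀ {i} → p ≤ i → i ≤ k → G′ (suc k) < G′ i) → ¬ AgreeUpTo (suc k) G G′
separatedByMin {G} {G′} {k = k} p≤j j≤k old new a =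
  1+n≰n (subst (_≤ k) (trans (cong proj₁ (minMaxOn-≡ a (m≤n⇒m≤1+n p≤k) ≤-refl))
                             (argminFrom-snoc-new G′ p≤k new))
                      (argminFrom-snoc-old G p≤j j≤k old))
  where
    p≤k : _ ≤ k
    p≤k = ≤-trans p≤j j≤k

-- Stretching and appending

-- Stretching doubles all values, so that odd numbers are free to be inserted
-- just below or just above any existing value.
stretch below above : ℕ → ℕ
stretch v = suc (suc (v + v))
below   v = suc (v + v)
above   v = suc (stretch v)

private
  double-< : ∀ {a b} → a < b → suc (suc (a + a)) ≤ b + b
  double-< {a} {b} a<b = subst (_≤ b + b) (cong suc (+-suc a a)) (+-mono-≤ a<b a<b)

stretch-mono-≤ : ∀ {a b} → a ≤ b → stretch a ≤ stretch b
stretch-mono-≤ a≤b = s≤s (s≤s (+-mono-≤ a≤b a≤b))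

stretch<above : ∀ {a b} → a ≤ b → stretch a < above b
stretch<above a≤b = s≤s (stretch-mono-≤ a≤b)

above<stretch : ∀ {a b} → a < b → above a < stretch b
above<stretch a<b = s≤s (s≤s (double-< a<b))

below<stretch : ∀ {a b} → a ≤ b → below a < stretch b
below<stretch a≤b = s≤s (s≤s (+-mono-≤ a≤b a≤b))

stretch<below : ∀ {a b} → a < b → stretch a < below b
stretch<below a<b = s≤s (double-< a<b)

stretch-mono-< : ∀ {a b} → a < b → stretch a < stretch b
stretch-mono-< a<b = ≤-trans (n≤1+n _) (above<stretch a<b)

stretch-<ᵇ : ∀ a b → (stretch a <ᵇ stretch b) ≡ (a <ᵇ b)
stretch-<ᵇ a b with a <ᵇ b in e
... | true  = <⇒<ᵇ≡true {stretch a} {stretch b} (stretch-mono-< {a} {b} (<ᵇ≡true⇒< e))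
... | false = ≥⇒<ᵇ≡false {stretch a} {stretch b} (stretch-mono-≤ {b} {a} (<ᵇ≡false⇒≥ e))

opaque
  append : ℕ → (ℕ → ℕ) → ℕ → ℕ → ℕ
  append k F x j = if j <ᵇ suc k then stretch (F j) else x

opaque
  unfolding append

  append-old : ∀ {k F x j} → j ≤ k → append k F x j ≡ stretch (F j)
  append-old j≤k rewrite <⇒<ᵇ≡true (s≤s j≤k) = refl

  append-new : ∀ {k F x} → append k F x (suc k) ≡ x
  append-new {k} rewrite ≥⇒<ᵇ≡false (≤-refl {suc k}) = refl

append-old-≤ : ∀ {k F x a b} → a ≤ k → b ≤ k → F a ≤ F b → append k F x a ≤ append k F x b
append-old-≤ a≤k b≤k Fa≤Fb =
  subst₂ _≤_ (sym (append-old a≤k)) (sym (append-old b≤k)) (stretch-mono-≤ Fa≤Fb)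

append-old-< : ∀ {k F x a b} → a ≤ k → b ≤ k → F a < F b → append k F x a < append k F x b
append-old-< a≤k b≤k Fa<Fb =
  subst₂ _<_ (sym (append-old a≤k)) (sym (append-old b≤k)) (stretch-mono-< Fa<Fb)

append-new-< : ∀ {k F x b} → b ≤ k → x < stretch (F b) → append k F x (suc k) < append k F x b
append-new-< b≤k x< = subst₂ _<_ (sym append-new) (sym (append-old b≤k)) x<

append-new-> : ∀ {k F x b} → b ≤ k → stretch (F b) < x → append k F x b < append k F x (suc k)
append-new-> b≤k <x = subst₂ _<_ (sym (append-old b≤k)) (sym append-new) <x

append-sameOrder : ∀ {k F x} → SameOrderUpTo k F (append k F x)
append-sameOrder {F = F} = sameOrder λ {a} {b} a≤k b≤k →
  sym (trans (cong₂ _<ᵇ_ (append-old a≤k) (append-old b≤k)) (stretch-<ᵇ (F a) (F b)))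

-- Stacks of suffix extrema

nth : List ℕ → ℕ → ℕ
nth []       _       = 0
nth (x ∷ xs) zero    = x
nth (x ∷ xs) (suc r) = nth xs r

nth-drop : ∀ m xs r → nth (drop m xs) r ≡ nth xs (m + r)
nth-drop zero    xs       r = refl
nth-drop (suc m) []       r = refl
nth-drop (suc m) (x ∷ xs) r = nth-drop m xs r

<-length-drop : ∀ m (xs : List ℕ) {r} → r < length (drop m xs) → m + r < length xs
<-length-drop zero    xs       r< = r<
<-length-drop (suc m) []       ()
<-length-drop (suc m) (x ∷ xs) r< = s≤s (<-length-drop m xs r<)

-- Stacks hold positions in [0, k], top first.
record IsMaxStack (k : ℕ) (F : ℕ → ℕ) (xs : List ℕ) : Set where
  field
    bounded   : ∀ {r} → r < length xs → nth xs r ≤ k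
    dominates : ∀ {r j} → r < length xs → nth xs r ≤ j → j ≤ k → F j ≤ F (nth xs r)
    ascending : ∀ {r s} → r < s → s < length xs → F (nth xs r) < F (nth xs s)

  last≤ : ∀ {r} → r < length xs → F k ≤ F (nth xs r)
  last≤ r< = dominates r< (bounded r<) ≤-refl

record IsMinStack (k : ℕ) (F : ℕ → ℕ) (xs : List ℕ) : Set where
  field
    bounded    : ∀ {r} → r < length xs → nth xs r ≤ k
    dominated  : ∀ {r j} → r < length xs → nth xs r ≤ j → j ≤ k → F (nth xs r) ≤ F j
    descending : ∀ {r s} → r < s → s < length xs → F (nth xs s) < F (nth xs r)

  ≤last : ∀ {r} → r < length xs → F (nth xs r) ≤ F k
  ≤last r< = dominated r< (bounded r<) ≤-refl

private
  ≤-suc-cases : ∀ {j k} → j ≤ suc k → j ≤ k ⊎ j ≡ suc k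
  ≤-suc-cases j≤ with m≤n⇒m<n∨m≡n j≤
  ... | inj₁ j<  = inj₁ (m<1+n⇒m≤n j<)
  ... | inj₂ j≡  = inj₂ j≡

module _ {k F xs} (S : IsMaxStack k F xs) (m x : ℕ) where
  open IsMaxStack S

  push-max : (∀ {r} → m ≤ r → r < length xs → x < stretch (F (nth xs r))) →
             IsMaxStack (suc k) (append k F x) (suc k ∷ drop m xs)
  IsMaxStack.bounded (push-max _) {zero} _ = ≤-refl
  IsMaxStack.bounded (push-max _) {suc t} t<
    rewrite nth-drop m xs t = m≤n⇒m≤1+n (bounded (<-length-drop m xs (s≤s⁻¹ t<)))
  IsMaxStack.dominates (push-max _) {zero} _ sk≤j j≤sk rewrite ≤-antisym j≤sk sk≤j = ≤-refl
  IsMaxStack.dominates (push-max x<) {suc t} {j} t< q≤j j≤sk rewrite nth-drop m xs t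
    with <-length-drop m xs (s≤s⁻¹ t<) | ≤-suc-cases j≤sk
  ... | r< | inj₁ j≤k  = append-old-≤ j≤k (bounded r<) (dominates r< q≤j j≤k)
  ... | r< | inj₂ refl = <⇒≤ (append-new-< (bounded r<) (x< (m≤m+n m t) r<))
  IsMaxStack.ascending (push-max x<) {zero} {suc t} _ t< rewrite nth-drop m xs t
    with <-length-drop m xs (s≤s⁻¹ t<)
  ... | r< = append-new-< (bounded r<) (x< (m≤m+n m t) r<)
  IsMaxStack.ascending (push-max _) {suc t} {suc t′} t<t′ t′< rewrite nth-drop m xs t | nth-drop m xs t′
    with <-length-drop m xs (s≤s⁻¹ t′<)
  ... | r′< = append-old-< (bounded (<-trans (+-monoʳ-< m (s≤s⁻¹ t<t′)) r′<)) (bounded r′<)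
                           (ascending (+-monoʳ-< m (s≤s⁻¹ t<t′)) r′<)

module _ {k F xs} (S : IsMinStack k F xs) (m x : ℕ) where
  open IsMinStack S

  push-min : (∀ {r} → m ≤ r → r < length xs → stretch (F (nth xs r)) < x) →
             IsMinStack (suc k) (append k F x) (suc k ∷ drop m xs)
  IsMinStack.bounded (push-min _) {zero} _ = ≤-refl
  IsMinStack.bounded (push-min _) {suc t} t<
    rewrite nth-drop m xs t = m≤n⇒m≤1+n (bounded (<-length-drop m xs (s≤s⁻¹ t<)))
  IsMinStack.dominated (push-min _) {zero} _ sk≤j j≤sk rewrite ≤-antisym j≤sk sk≤j = ≤-refl
  IsMinStack.dominated (push-min <x) {suc t} {j} t< q≤j j≤sk rewrite nth-drop m xs t
    with <-length-drop m xs (s≤s⁻¹ t<) | ≤-suc-cases j≤sk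
  ... | r< | inj₁ j≤k  = append-old-≤ (bounded r<) j≤k (dominated r< q≤j j≤k)
  ... | r< | inj₂ refl = <⇒≤ (append-new-> (bounded r<) (<x (m≤m+n m t) r<))
  IsMinStack.descending (push-min <x) {zero} {suc t} _ t< rewrite nth-drop m xs t
    with <-length-drop m xs (s≤s⁻¹ t<)
  ... | r< = append-new-> (bounded r<) (<x (m≤m+n m t) r<)
  IsMinStack.descending (push-min _) {suc t} {suc t′} t<t′ t′< rewrite nth-drop m xs t | nth-drop m xs t′
    with <-length-drop m xs (s≤s⁻¹ t′<)
  ... | r′< = append-old-< (bounded r′<) (bounded (<-trans (+-monoʳ-< m (s≤s⁻¹ t<t′)) r′<))
                           (descending (+-monoʳ-< m (s≤s⁻¹ t<t′)) r′<)

-- Building arrays step by step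

record Config : Set where
  constructor config
  field
    end      : ℕ
    values   : ℕ → ℕ
    minStack : List ℕ
    maxStack : List ℕ
open Config

record Valid (α β : ℕ) (c : Config) : Set where
  field
    minStack-long : α ≤ length (minStack c)
    maxStack-long : β ≤ length (maxStack c)
    minStack-ok   : IsMinStack (end c) (values c) (minStack c)
    maxStack-ok   : IsMaxStack (end c) (values c) (maxStack c)
open Valid

-- up r (down r): the new element passes exactly the top r + 1 entries of the
-- max (min) stack.
data Step (α β : ℕ) : Set where
  tie  : Step α β
  up   : Fin β → Step α β
  down : Fin α → Step α β

-- Only lower bounds on the stack lengths are tracked, capped at K so that just
-- finitely many pairs of bounds occur.
K : ℕ
K = 10

minBound maxBound : ∀ {α β} → Step α β → ℕ
minBound {α} tie      = α
minBound {α} (up r)   = suc α ⊓ K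
minBound {α} (down r) = α ∸ toℕ r
maxBound {β = β} tie      = β
maxBound {β = β} (up r)   = β ∸ toℕ r
maxBound {β = β} (down r) = suc β ⊓ K

minPops maxPops : ∀ {α β} → Step α β → ℕ
minPops tie      = 1
minPops (up r)   = 0
minPops (down r) = suc (toℕ r)
maxPops tie      = 1
maxPops (up r)   = suc (toℕ r)
maxPops (down r) = 0

newValue : ∀ {α β} → Step α β → Config → ℕ
newValue tie      c = stretch (values c (end c))
newValue (up r)   c = above (values c (nth (maxStack c) (toℕ r)))
newValue (down r) c = below (values c (nth (minStack c) (toℕ r)))

step : ∀ {α β} → Step α β → Config → Config
step s c = config (suc (end c))
                  (append (end c) (values c) (newValue s c))
                  (suc (end c) ∷ drop (minPops s) (minStack c))
                  (suc (end c) ∷ drop (maxPops s) (maxStack c))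

∸-≤-length-drop : ∀ m {n} (xs : List ℕ) → n ≤ length xs → n ∸ m ≤ suc (length (drop (suc m) xs))
∸-≤-length-drop m       {n} []       n≤0 = ≤-trans (m∸n≤m n m) (≤-trans n≤0 z≤n)
∸-≤-length-drop zero    (x ∷ xs) n≤    = n≤
∸-≤-length-drop (suc m) {zero}  (x ∷ xs) _  = z≤n
∸-≤-length-drop (suc m) {suc n} (x ∷ xs) n≤ = ∸-≤-length-drop m xs (s≤s⁻¹ n≤)

module _ {α β c} (v : Valid α β c) where
  private
    k : ℕ
    k = end c

    open IsMaxStack (maxStack-ok v)
    open IsMinStack (minStack-ok v) renaming (bounded to min-bounded)

    <max : (r : Fin β) → toℕ r < length (maxStack c)
    <max r = <-≤-trans (Finₚ.toℕ<n r) (maxStack-long v)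

    <min : (r : Fin α) → toℕ r < length (minStack c)
    <min r = <-≤-trans (Finₚ.toℕ<n r) (minStack-long v)

  step-valid : (s : Step α β) → Valid (minBound s) (maxBound s) (step s c)
  step-valid tie = record
    { minStack-long = ∸-≤-length-drop 0 (minStack c) (minStack-long v)
    ; maxStack-long = ∸-≤-length-drop 0 (maxStack c) (maxStack-long v)
    ; minStack-ok   = push-min (minStack-ok v) 1 _ λ 1≤r r< →
        stretch-mono-< (<-≤-trans (descending 1≤r r<) (≤last (≤-<-trans z≤n r<)))
    ; maxStack-ok   = push-max (maxStack-ok v) 1 _ λ 1≤r r< →
        stretch-mono-< (≤-<-trans (last≤ (≤-<-trans z≤n r<)) (ascending 1≤r r<))
    }
  step-valid (up r) = record
    { minStack-long = ≤-trans (m⊓n≤m _ K) (s≤s (minStack-long v))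
    ; maxStack-long = ∸-≤-length-drop (toℕ r) (maxStack c) (maxStack-long v)
    ; minStack-ok   = push-min (minStack-ok v) 0 _ λ _ t< → stretch<above (≤-trans (≤last t<) (last≤ (<max r)))
    ; maxStack-ok   = push-max (maxStack-ok v) (suc (toℕ r)) _ λ r< r′< → above<stretch (ascending r< r′<)
    }
  step-valid (down r) = record
    { minStack-long = ∸-≤-length-drop (toℕ r) (minStack c) (minStack-long v)
    ; maxStack-long = ≤-trans (m⊓n≤m _ K) (s≤s (maxStack-long v))
    ; minStack-ok   = push-min (minStack-ok v) (suc (toℕ r)) _ λ r< r′< → stretch<below (descending r< r′<)
    ; maxStack-ok   = push-max (maxStack-ok v) 0 _ λ _ t< → below<stretch (≤-trans (≤last (<min r)) (last≤ t<))
    }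

  private
    G : Step α β → ℕ → ℕ
    G s = values (step s c)

    tie-up : (r : Fin β) → ¬ AgreeUpTo (suc k) (G tie) (G (up r))
    tie-up r = separatedByMax ≤-refl ≤-refl
      (≤-reflexive (trans append-new (sym (append-old ≤-refl))))
      (λ k≤i i≤k → append-new-> i≤k
                      (stretch<above (dominates (<max r) (≤-trans (bounded (<max r)) k≤i) i≤k)))

    tie-down : (r : Fin α) → ¬ AgreeUpTo (suc k) (G tie) (G (down r))
    tie-down r = separatedByMin ≤-refl ≤-refl
      (≤-reflexive (trans (append-old ≤-refl) (sym append-new)))
      (λ k≤i i≤k → append-new-< i≤k
                      (below<stretch (dominated (<min r) (≤-trans (min-bounded (<min r)) k≤i) i≤k)))

    down-up : (r : Fin α) (r′ : Fin β) → ¬ AgreeUpTo (suc k) (G (down r)) (G (up r′))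
    down-up r r′ = separatedByMax ≤-refl ≤-refl
      (<⇒≤ (append-new-< ≤-refl (below<stretch (≤last (<min r)))))
      (λ k≤i i≤k → append-new-> i≤k
                      (stretch<above (dominates (<max r′) (≤-trans (bounded (<max r′)) k≤i) i≤k)))

    up-up : (r r′ : Fin β) → toℕ r < toℕ r′ → ¬ AgreeUpTo (suc k) (G (up r)) (G (up r′))
    up-up r r′ r<r′ = separatedByMax ≤-refl (bounded (<max r′))
      (<⇒≤ (append-new-< (bounded (<max r′)) (above<stretch (ascending r<r′ (<max r′)))))
      (λ p≤i i≤k → append-new-> i≤k (stretch<above (dominates (<max r′) p≤i i≤k)))

    down-down : (r r′ : Fin α) → toℕ r < toℕ r′ → ¬ AgreeUpTo (suc k) (G (down r)) (G (down r′))
    down-down r r′ r<r′ = separatedByMin ≤-refl (min-bounded (<min r′))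
      (<⇒≤ (append-new-> (min-bounded (<min r′)) (stretch<below (descending r<r′ (<min r′)))))
      (λ p≤i i≤k → append-new-< i≤k (below<stretch (dominated (<min r′) p≤i i≤k)))

  step-separates : (s s′ : Step α β) →
                   s ≡ s′ ⊎ ¬ AgreeUpTo (suc (end c)) (values (step s c)) (values (step s′ c))
  step-separates tie      tie       = inj₁ refl
  step-separates tie      (up r)    = inj₂ (tie-up r)
  step-separates tie      (down r)  = inj₂ (tie-down r)
  step-separates (up r)   tie       = inj₂ (disagree-sym (tie-up r))
  step-separates (down r) tie       = inj₂ (disagree-sym (tie-down r))
  step-separates (up r)   (down r′) = inj₂ (disagree-sym (down-up r′ r))
  step-separates (down r) (up r′)   = inj₂ (down-up r r′)
  step-separates (up r)   (up r′) with <-cmp (toℕ r) (toℕ r′)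
  ... | tri< r<r′ _ _ = inj₂ (up-up r r′ r<r′)
  ... | tri≈ _ r≡r′ _ = inj₁ (cong up (Finₚ.toℕ-injective r≡r′))
  ... | tri> _ _ r′<r = inj₂ (disagree-sym (up-up r′ r r′<r))
  step-separates (down r) (down r′) with <-cmp (toℕ r) (toℕ r′)
  ... | tri< r<r′ _ _ = inj₂ (down-down r r′ r<r′)
  ... | tri≈ _ r≡r′ _ = inj₁ (cong down (Finₚ.toℕ-injective r≡r′))
  ... | tri> _ _ r′<r = inj₂ (disagree-sym (down-down r′ r r′<r))

data Path : ℕ → ℕ → ℕ → Set where
  []  : ∀ {α β} → Path α β 0
  _∷_ : ∀ {α β ℓ} (s : Step α β) → Path (minBound s) (maxBound s) ℓ → Path α β (suc ℓ)

run : ∀ {α β ℓ} → Path α β ℓ → Config → Config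
run []      c = c
run (s ∷ P) c = run P (step s c)

run-sameOrder : ∀ {α β ℓ} (P : Path α β ℓ) c → SameOrderUpTo (end c) (values c) (values (run P c))
run-sameOrder []      c = sameOrder λ _ _ → refl
run-sameOrder (s ∷ P) c = sameOrder-trans append-sameOrder (sameOrder-mono (n≤1+n _) (run-sameOrder P (step s c)))

run-injective : ∀ {α β ℓ c} → Valid α β c → (P P′ : Path α β ℓ) →
                AgreeUpTo (end c + ℓ) (values (run P c)) (values (run P′ c)) → P ≡ P′
run-injective v [] [] _ = refl
run-injective {ℓ = suc ℓ} {c} v (s ∷ P) (s′ ∷ P′) a
  with step-separates v s s′ | agree-mono (≤-reflexive (sym (+-suc (end c) ℓ))) a
... | inj₁ refl  | a′ = cong (s ∷_) (run-injective (step-valid v s) P P′ a′)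
... | inj₂ apart | a′ = ⊥-elim (apart (agree-trans (sameOrder⇒agree (run-sameOrder P _))
                              (agree-trans (agree-mono (m≤m+n _ ℓ) a′)
                                           (agree-sym (sameOrder⇒agree (run-sameOrder P′ _))))))

-- Counting paths

∑ : (m : ℕ) → (Fin m → ℕ) → ℕ
∑ zero    f = 0
∑ (suc m) f = f zero + ∑ m (f ∘ suc)

∑-split : ∀ m (f : Fin m → ℕ) → Fin (∑ m f) → Σ (Fin m) (Fin ∘ f)
∑-split (suc m) f i with splitAt (f zero) i
... | inj₁ j = zero , j
... | inj₂ j = map suc id (∑-split m (f ∘ suc) j)

∑-join : ∀ m (f : Fin m → ℕ) → Σ (Fin m) (Fin ∘ f) → Fin (∑ m f)
∑-join (suc m) f (zero  , j) = j ↑ˡ ∑ m (f ∘ suc)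
∑-join (suc m) f (suc r , j) = f zero ↑ʳ ∑-join m (f ∘ suc) (r , j)

∑-join-split : ∀ m (f : Fin m → ℕ) i → ∑-join m f (∑-split m f i) ≡ i
∑-join-split (suc m) f i with splitAt (f zero) i in eq
... | inj₁ j = Finₚ.splitAt⁻¹-↑ˡ eq
... | inj₂ j = trans (cong (f zero ↑ʳ_) (∑-join-split m (f ∘ suc) j)) (Finₚ.splitAt⁻¹-↑ʳ eq)

∑-scale : ∀ m (f : Fin m → ℕ) c → c * ∑ m f ≡ ∑ m (λ r → c * f r)
∑-scale zero    f c = *-zeroʳ c
∑-scale (suc m) f c = trans (*-distribˡ-+ c (f zero) _) (cong (c * f zero +_) (∑-scale m (f ∘ suc) c))

∑-mono : ∀ m {f g : Fin m → ℕ} → (∀ r → f r ≤ g r) → ∑ m f ≤ ∑ m g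
∑-mono zero    f≤g = z≤n
∑-mono (suc m) f≤g = +-mono-≤ (f≤g zero) (∑-mono m (f≤g ∘ suc))

after : (ℕ → ℕ → ℕ) → ∀ {α β} → Step α β → ℕ
after u s = u (minBound s) (maxBound s)

viaTie viaUp viaDown : (ℕ → ℕ → ℕ) → ℕ → ℕ → ℕ
viaTie  u α β = after u (tie {α} {β})
viaUp   u α β = ∑ β (λ r → after u (up {α} r))
viaDown u α β = ∑ α (λ r → after u (down {β = β} r))

transfer : (ℕ → ℕ → ℕ) → ℕ → ℕ → ℕ
transfer u α β = viaTie u α β + (viaUp u α β + viaDown u α β)

transfer-scale : ∀ c u α β → c * transfer u α β ≡ transfer (λ a b → c * u a b) α β
transfer-scale c u α β = begin
  c * (viaTie u α β + (viaUp u α β + viaDown u α β))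
    ≡⟨ *-distribˡ-+ c _ _ ⟩
  c * viaTie u α β + c * (viaUp u α β + viaDown u α β)
    ≡⟨ cong (c * viaTie u α β +_) (*-distribˡ-+ c _ _) ⟩
  c * viaTie u α β + (c * viaUp u α β + c * viaDown u α β)
    ≡⟨ cong (c * viaTie u α β +_) (cong₂ _+_ (∑-scale β _ c) (∑-scale α _ c)) ⟩
  transfer (λ a b → c * u a b) α β ∎
  where open ≡-Reasoning

transfer-mono : ∀ {u u′} → (∀ a b → u a b ≤ u′ a b) → ∀ α β → transfer u α β ≤ transfer u′ α β
transfer-mono u≤u′ α β =
  +-mono-≤ (u≤u′ α β) (+-mono-≤ (∑-mono β (λ r → u≤u′ _ _)) (∑-mono α (λ r → u≤u′ _ _)))

count : ℕ → ℕ → ℕ → ℕ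
count zero    α β = 1
count (suc ℓ) α β = transfer (count ℓ) α β

unrank : ∀ {α β} ℓ → Fin (count ℓ α β) → Path α β ℓ
unrank zero _ = []
unrank {α} {β} (suc ℓ) i with splitAt (viaTie (count ℓ) α β) i
... | inj₁ i₀ = tie ∷ unrank ℓ i₀
... | inj₂ i₁ with splitAt (viaUp (count ℓ) α β) i₁
...   | inj₁ i↑ = up   (proj₁ (∑-split β _ i↑)) ∷ unrank ℓ (proj₂ (∑-split β _ i↑))
...   | inj₂ i↓ = down (proj₁ (∑-split α _ i↓)) ∷ unrank ℓ (proj₂ (∑-split α _ i↓))

rank : ∀ {α β ℓ} → Path α β ℓ → Fin (count ℓ α β)
rank [] = zero
rank {α} {β} {suc ℓ} (tie ∷ P) =
  rank P ↑ˡ (viaUp (count ℓ) α β + viaDown (count ℓ) α β)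
rank {α} {β} {suc ℓ} (up r ∷ P) =
  viaTie (count ℓ) α β ↑ʳ (∑-join β _ (r , rank P) ↑ˡ viaDown (count ℓ) α β)
rank {α} {β} {suc ℓ} (down r ∷ P) =
  viaTie (count ℓ) α β ↑ʳ (viaUp (count ℓ) α β ↑ʳ ∑-join α _ (r , rank P))

rank-unrank : ∀ {α β} ℓ i → rank (unrank {α} {β} ℓ i) ≡ i
rank-unrank zero    zero = refl
rank-unrank {α} {β} (suc ℓ) i with splitAt (viaTie (count ℓ) α β) i in eq
... | inj₁ i₀ = trans (cong (_↑ˡ _) (rank-unrank ℓ i₀)) (Finₚ.splitAt⁻¹-↑ˡ eq)
... | inj₂ i₁ with splitAt (viaUp (count ℓ) α β) i₁ in eq′
...   | inj₁ i↑ = trans (cong (viaTie (count ℓ) α β ↑ʳ_) (trans (cong (_↑ˡ viaDown (count ℓ) α β) (begin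
    ∑-join β f (r , rank (unrank ℓ i′)) ≡⟨ cong (λ j → ∑-join β f (r , j)) (rank-unrank ℓ i′) ⟩
    ∑-join β f (r , i′)                 ≡⟨ ∑-join-split β f i↑ ⟩
    i↑                                  ∎)) (Finₚ.splitAt⁻¹-↑ˡ eq′))) (Finₚ.splitAt⁻¹-↑ʳ eq)
  where
    open ≡-Reasoning
    f : Fin β → ℕ
    f r = after (count ℓ) (up {α} r)
    r : Fin β
    r = proj₁ (∑-split β f i↑)
    i′ : Fin (f r)
    i′ = proj₂ (∑-split β f i↑)
...   | inj₂ i↓ = trans (cong (viaTie (count ℓ) α β ↑ʳ_) (trans (cong (viaUp (count ℓ) α β ↑ʳ_) (begin
    ∑-join α f (r , rank (unrank ℓ i′)) ≡⟨ cong (λ j → ∑-join α f (r , j)) (rank-unrank ℓ i′) ⟩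
    ∑-join α f (r , i′)                 ≡⟨ ∑-join-split α f i↓ ⟩
    i↓                                  ∎)) (Finₚ.splitAt⁻¹-↑ʳ eq′))) (Finₚ.splitAt⁻¹-↑ʳ eq)
  where
    open ≡-Reasoning
    f : Fin α → ℕ
    f r = after (count ℓ) (down {β = β} r)
    r : Fin α
    r = proj₁ (∑-split α f i↓)
    i′ : Fin (f r)
    i′ = proj₂ (∑-split α f i↓)

unrank-injective : ∀ {α β} ℓ {i j} → unrank {α} {β} ℓ i ≡ unrank ℓ j → i ≡ j
unrank-injective ℓ {i} {j} eq = trans (sym (rank-unrank ℓ i)) (trans (cong rank eq) (rank-unrank ℓ j))

count-growth : ∀ ρ V u → (∀ α β → ρ * u α β ≤ transfer u α β) → (∀ α β → u α β ≤ V) →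
               ∀ ℓ α β → ρ ^ ℓ * u α β ≤ V * count ℓ α β
count-growth ρ V u sub bounded zero α β =
  subst₂ _≤_ (sym (+-identityʳ (u α β))) (sym (*-identityʳ V)) (bounded α β)
count-growth ρ V u sub bounded (suc ℓ) α β = begin
  ρ * ρ ^ ℓ * u α β                           ≡⟨ cong (_* u α β) (*-comm ρ (ρ ^ ℓ)) ⟩
  ρ ^ ℓ * ρ * u α β                           ≡⟨ *-assoc (ρ ^ ℓ) ρ (u α β) ⟩
  ρ ^ ℓ * (ρ * u α β)                         ≤⟨ *-monoʳ-≤ (ρ ^ ℓ) (sub α β) ⟩
  ρ ^ ℓ * transfer u α β                      ≡⟨ transfer-scale (ρ ^ ℓ) u α β ⟩
  transfer (λ a b → ρ ^ ℓ * u a b) α β        ≤⟨ transfer-mono (count-growth ρ V u sub bounded ℓ) α β ⟩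
  transfer (λ a b → V * count ℓ a b) α β      ≡⟨ transfer-scale V (count ℓ) α β ⟨
  V * count (suc ℓ) α β                       ∎
  where open ≤-Reasoning

-- A certificate for growth rate 8

allUpTo : ℕ → (ℕ → Bool) → Bool
allUpTo zero    p = p zero
allUpTo (suc m) p = p (suc m) ∧ allUpTo m p

allUpTo-sound : ∀ m p → T (allUpTo m p) → ∀ {i} → i ≤ m → T (p i)
allUpTo-sound zero    p all z≤n = all
allUpTo-sound (suc m) p all {i} i≤ with m≤n⇒m<n∨m≡n i≤ | Equivalence.to T-∧ all
... | inj₁ i<  | _ , rest = allUpTo-sound m p rest (m<1+n⇒m≤n i<)
... | inj₂ refl | now , _ = now

-- A positive sub-eigenvector of transfer for the eigenvalue 8, found
-- numerically; row α, column β holds w (1 + α) (1 + β).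
weights : List (List ℕ)
weights = (7 ∷ 27 ∷ 78 ∷ 197 ∷ 453 ∷ 968 ∷ 1938 ∷ 3624 ∷ 6231 ∷ 9318 ∷ [])
        ∷ (27 ∷ 91 ∷ 246 ∷ 591 ∷ 1309 ∷ 2704 ∷ 5228 ∷ 9419 ∷ 15501 ∷ 22015 ∷ [])
        ∷ (78 ∷ 246 ∷ 640 ∷ 1492 ∷ 3210 ∷ 6449 ∷ 12125 ∷ 21201 ∷ 33772 ∷ 46452 ∷ [])
        ∷ (197 ∷ 591 ∷ 1492 ∷ 3388 ∷ 7106 ∷ 13924 ∷ 25525 ∷ 43468 ∷ 67373 ∷ 90424 ∷ [])
        ∷ (453 ∷ 1309 ∷ 3210 ∷ 7106 ∷ 14553 ∷ 27849 ∷ 49839 ∷ 82792 ∷ 125154 ∷ 164388 ∷ [])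
        ∷ (968 ∷ 2704 ∷ 6449 ∷ 13924 ∷ 27849 ∷ 52058 ∷ 90974 ∷ 147475 ∷ 217546 ∷ 279802 ∷ [])
        ∷ (1938 ∷ 5228 ∷ 12125 ∷ 25525 ∷ 49839 ∷ 90974 ∷ 155176 ∷ 245346 ∷ 352893 ∷ 443985 ∷ [])
        ∷ (3624 ∷ 9419 ∷ 21201 ∷ 43468 ∷ 82792 ∷ 147475 ∷ 245346 ∷ 377908 ∷ 529071 ∷ 649630 ∷ [])
        ∷ (6231 ∷ 15501 ∷ 33772 ∷ 67373 ∷ 125154 ∷ 217546 ∷ 352893 ∷ 529071 ∷ 719557 ∷ 859778 ∷ [])
        ∷ (9318 ∷ 22015 ∷ 46452 ∷ 90424 ∷ 164388 ∷ 279802 ∷ 443985 ∷ 649630 ∷ 859778 ∷ 1000000 ∷ [])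
        ∷ []

row : List (List ℕ) → ℕ → List ℕ
row []         _       = []
row (xs ∷ xss) zero    = xs
row (xs ∷ xss) (suc α) = row xss α

w : ℕ → ℕ → ℕ
w (suc α) (suc β) = if (α <ᵇ K) ∧ (β <ᵇ K) then nth (row weights α) β else 0
w _       _       = 0

w-outside : ∀ α β → K < α ⊎ K < β → w α β ≡ 0
w-outside zero    β       _ = refl
w-outside (suc α) zero    _ = refl
w-outside (suc α) (suc β) (inj₁ K<α) rewrite ≥⇒<ᵇ≡false (s≤s⁻¹ K<α) = refl
w-outside (suc α) (suc β) (inj₂ K<β) rewrite ≥⇒<ᵇ≡false (s≤s⁻¹ K<β) | ∧-zeroʳ (α <ᵇ K) = refl

certificate : ℕ → ℕ → Bool
certificate α β = (8 * w α β ≤ᵇ transfer w α β) ∧ (w α β ≤ᵇ 1000000)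

certificate-checked : T (allUpTo K λ α → allUpTo K (certificate α))
certificate-checked = tt

certificate-holds : ∀ {α β} → α ≤ K → β ≤ K → T (certificate α β)
certificate-holds {α} α≤K =
  allUpTo-sound K (certificate α) (allUpTo-sound K (λ α → allUpTo K (certificate α)) certificate-checked α≤K)

w-certified : ∀ α β → 8 * w α β ≤ transfer w α β × w α β ≤ 1000000
w-certified α β with α ≤? K | β ≤? K
... | yes α≤K | yes β≤K = map (≤ᵇ⇒≤ _ _) (≤ᵇ⇒≤ _ _) (Equivalence.to T-∧ (certificate-holds α≤K β≤K))
... | no  α≰K | _       rewrite w-outside α β (inj₁ (≰⇒> α≰K)) = z≤n , z≤n
... | yes _   | no  β≰K rewrite w-outside α β (inj₂ (≰⇒> β≰K)) = z≤n , z≤n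

8^<count : ∀ {α β a V} c → V < a * 8 ^ c → (∀ ℓ → 8 ^ ℓ * a ≤ V * count ℓ α β) →
            ∀ t → 8 ^ t < count (c + t) α β
8^<count {α} {β} {a} {V} c V<a8^c growth t = *-cancelˡ-< V _ _ (begin-strict
  V * 8 ^ t           <⟨ *-monoˡ-< (8 ^ t) {{m^n≢0 8 t}} V<a8^c ⟩
  a * 8 ^ c * 8 ^ t   ≡⟨ *-assoc a (8 ^ c) (8 ^ t) ⟩
  a * (8 ^ c * 8 ^ t) ≡⟨ cong (a *_) (^-distribˡ-+-* 8 c t) ⟨
  a * 8 ^ (c + t)     ≡⟨ *-comm a (8 ^ (c + t)) ⟩
  8 ^ (c + t) * a     ≤⟨ growth (c + t) ⟩
  V * count (c + t) α β ∎)
  where open ≤-Reasoning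

-- The implicit arguments of 8^<count are given explicitly: left to unification,
-- they make Agda unfold 1000000 * _ one step at a time.
paths-outnumber : ∀ t → 2 ^ (3 * t) < count (6 + t) 1 1
paths-outnumber t = subst (_< count (6 + t) 1 1) (^-*-assoc 2 3 t)
  (8^<count {1} {1} {w 1 1} {1000000} 6 (<ᵇ⇒< 1000000 (w 1 1 * 8 ^ 6) _)
            (λ ℓ → count-growth 8 1000000 w (λ α β → proj₁ (w-certified α β))
                                            (λ α β → proj₂ (w-certified α β)) ℓ 1 1) t)

-- Encodings

singleton-isMaxStack : ∀ {k F} → IsMaxStack k F (k ∷ [])
IsMaxStack.bounded   singleton-isMaxStack {zero}  _ = ≤-refl
IsMaxStack.bounded   singleton-isMaxStack {suc r} (s≤s ())
IsMaxStack.dominates singleton-isMaxStack {zero}  _ k≤j j≤k rewrite ≤-antisym j≤k k≤j = ≤-refl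
IsMaxStack.dominates singleton-isMaxStack {suc r} (s≤s ())
IsMaxStack.ascending singleton-isMaxStack {zero} {suc s} _ (s≤s ())

singleton-isMinStack : ∀ {k F} → IsMinStack k F (k ∷ [])
IsMinStack.bounded    singleton-isMinStack {zero}  _ = ≤-refl
IsMinStack.bounded    singleton-isMinStack {suc r} (s≤s ())
IsMinStack.dominated  singleton-isMinStack {zero}  _ k≤j j≤k rewrite ≤-antisym j≤k k≤j = ≤-refl
IsMinStack.dominated  singleton-isMinStack {suc r} (s≤s ())
IsMinStack.descending singleton-isMinStack {zero} {suc s} _ (s≤s ())

initial : Config
initial = config 0 (λ _ → 0) (0 ∷ []) (0 ∷ [])

initial-valid : Valid 1 1 initial
initial-valid = record
  { minStack-long = ≤-refl
  ; maxStack-long = ≤-refl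
  ; minStack-ok   = singleton-isMinStack
  ; maxStack-ok   = singleton-isMaxStack
  }

pathArray : ∀ {ℓ} → Path 1 1 ℓ → Array (suc ℓ)
pathArray P i = values (run P initial) (toℕ i)

ext-tabulate : ∀ n (G : ℕ → ℕ) {x} → x < n → ext {n} (G ∘ toℕ) x ≡ G x
ext-tabulate (suc n) G {zero}  _  = refl
ext-tabulate (suc n) G {suc x} x< = ext-tabulate n (G ∘ suc) (s≤s⁻¹ x<)

RMinMax-tabulate : ∀ {n} (G : ℕ → ℕ) (a b : Fin n) → toℕ a ≤ toℕ b →
                   RMinMax (G ∘ toℕ) a b ≡ minMaxOn G (toℕ a) (toℕ b)
RMinMax-tabulate {n} G a b a≤b = minMaxOn-≡ (sameOrder⇒agree same) a≤b ≤-refl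
  where
    same : SameOrderUpTo (toℕ b) (ext {n} (G ∘ toℕ)) G
    same = sameOrder λ x≤b y≤b → cong₂ _<ᵇ_ (ext-tabulate n G (≤-<-trans x≤b (Finₚ.toℕ<n b)))
                                            (ext-tabulate n G (≤-<-trans y≤b (Finₚ.toℕ<n b)))

pathArray-injective : ∀ {ℓ} (P P′ : Path 1 1 ℓ) →
                      (∀ a b → toℕ a ≤ toℕ b → RMinMax (pathArray P) a b ≡ RMinMax (pathArray P′) a b) →
                      P ≡ P′
pathArray-injective {ℓ} P P′ same = run-injective initial-valid P P′ (agree agreement)
  where
    agreement : ∀ {i j} → i ≤ j → j ≤ ℓ →
                minMaxOn (values (run P initial)) i j ≡ minMaxOn (values (run P′ initial)) i j
    agreement {i} {j} i≤j j≤ℓ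
      with fromℕ< (s≤s (≤-trans i≤j j≤ℓ)) | Finₚ.toℕ-fromℕ< (s≤s (≤-trans i≤j j≤ℓ))
         | fromℕ< (s≤s j≤ℓ) | Finₚ.toℕ-fromℕ< (s≤s j≤ℓ)
    ... | a | refl | b | refl =
      trans (sym (RMinMax-tabulate _ a b i≤j)) (trans (same a b i≤j) (RMinMax-tabulate _ a b i≤j))

-- The leading 1 separates lists of different lengths.
bits→ℕ : List Bool → ℕ
bits→ℕ []           = 1
bits→ℕ (false ∷ bs) = 2 * bits→ℕ bs
bits→ℕ (true  ∷ bs) = suc (2 * bits→ℕ bs)

bits→ℕ-positive : ∀ bs → 0 < bits→ℕ bs
bits→ℕ-positive []           = s≤s z≤n
bits→ℕ-positive (false ∷ bs) = *-monoʳ-< 2 (bits→ℕ-positive bs)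
bits→ℕ-positive (true  ∷ bs) = s≤s z≤n

bits→ℕ-injective : ∀ bs cs → bits→ℕ bs ≡ bits→ℕ cs → bs ≡ cs
bits→ℕ-injective []           []           _ = refl
bits→ℕ-injective []           (false ∷ cs) e = ⊥-elim (even≢odd (bits→ℕ cs) 0 (sym e))
bits→ℕ-injective (false ∷ bs) []           e = ⊥-elim (even≢odd (bits→ℕ bs) 0 e)
bits→ℕ-injective []           (true  ∷ cs) e =
  ⊥-elim (<⇒≢ (*-monoʳ-< 2 (bits→ℕ-positive cs)) (suc-injective e))
bits→ℕ-injective (true  ∷ bs) []           e =
  ⊥-elim (<⇒≢ (*-monoʳ-< 2 (bits→ℕ-positive bs)) (sym (suc-injective e)))
bits→ℕ-injective (false ∷ bs) (true  ∷ cs) e = ⊥-elim (even≢odd (bits→ℕ bs) (bits→ℕ cs) e)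
bits→ℕ-injective (true  ∷ bs) (false ∷ cs) e = ⊥-elim (even≢odd (bits→ℕ cs) (bits→ℕ bs) (sym e))
bits→ℕ-injective (false ∷ bs) (false ∷ cs) e =
  cong (false ∷_) (bits→ℕ-injective bs cs (*-cancelˡ-≡ _ _ 2 e))
bits→ℕ-injective (true  ∷ bs) (true  ∷ cs) e =
  cong (true ∷_) (bits→ℕ-injective bs cs (*-cancelˡ-≡ _ _ 2 (suc-injective e)))

bits→ℕ-< : ∀ bs → bits→ℕ bs < 2 ^ suc (length bs)
bits→ℕ-< []           = s≤s (s≤s z≤n)
bits→ℕ-< (false ∷ bs) = *-monoʳ-< 2 (bits→ℕ-< bs)
bits→ℕ-< (true  ∷ bs) =
  subst (_≤ 2 ^ suc (suc (length bs))) (*-suc 2 (bits→ℕ bs)) (*-monoʳ-≤ 2 (bits→ℕ-< bs))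

shortCode : ∀ {L} bs → .(length bs < L) → Fin (2 ^ L)
shortCode bs short = fromℕ< (<-≤-trans (bits→ℕ-< bs) (^-monoʳ-≤ 2 short))

shortCode-injective : ∀ {L} bs cs .{p : length bs < L} .{q : length cs < L} →
                      shortCode bs p ≡ shortCode cs q → bs ≡ cs
shortCode-injective bs cs e =
  bits→ℕ-injective bs cs (trans (sym (Finₚ.toℕ-fromℕ< _)) (trans (cong toℕ e) (Finₚ.toℕ-fromℕ< _)))

short-collision : ∀ {m L} (f : Fin m → List Bool) → 2 ^ L < m → (∀ i → length (f i) < L) →
                  ∃[ i ] ∃[ j ] i Fin.< j × f i ≡ f j
short-collision f 2^L<m short with Finₚ.pigeonhole 2^L<m (λ i → shortCode (f i) (short i))
... | i , j , i<j , same = i , j , i<j , shortCode-injective (f i) (f j) {short i} {short j} same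

some-long : ∀ {m L} (f : Fin m → List Bool) → 2 ^ L < m → (∀ {i j} → f i ≡ f j → i ≡ j) →
            ∃[ i ] L ≤ length (f i)
some-long {L = L} f 2^L<m f-injective with Finₚ.any? (λ i → L ≤? length (f i))
... | yes long = long
... | no none with short-collision f 2^L<m (λ i → ≰⇒> (λ long → none (i , long)))
...   | i , j , i<j , same = ⊥-elim (Finₚ.<⇒≢ i<j (f-injective same))

encoding-long : ∀ {ℓ L} → 2 ^ L < count ℓ 1 1 →
                (enc : Array (suc ℓ) → List Bool) (dec : List Bool → Fin (suc ℓ) → Fin (suc ℓ) → ℕ × ℕ) →
                (∀ A i j → toℕ i ≤ toℕ j → dec (enc A) i j ≡ RMinMax A i j) →
                ∃[ A ] L ≤ length (enc A)
encoding-long {ℓ} many enc dec correct =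
  map (pathArray ∘ unrank ℓ) id (some-long (enc ∘ pathArray ∘ unrank ℓ) many injective)
  where
    injective : ∀ {i j} → enc (pathArray (unrank ℓ i)) ≡ enc (pathArray (unrank ℓ j)) → i ≡ j
    injective {i} {j} e = unrank-injective ℓ (pathArray-injective (unrank ℓ i) (unrank ℓ j) λ a b a≤b →
      trans (sym (correct _ a b a≤b)) (trans (cong (λ bs → dec bs a b) e) (correct _ a b a≤b)))

RMinMaxLowerBound : ℕ → ℕ → Set
RMinMaxLowerBound c n =
  (enc : Array n → List Bool) → (dec : List Bool → Fin n → Fin n → ℕ × ℕ) →
  (∀ (A : Array n) (i j : Fin n) → toℕ i ≤ toℕ j → dec (enc A) i j ≡ RMinMax A i j) →
  ∃[ A ] 3 * n ≤ length (enc A) + c * ⌊log₂ n ⌋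

1≤⌊log₂⌋ : ∀ n → 2 ≤ n → 1 ≤ ⌊log₂ n ⌋
1≤⌊log₂⌋ n 2≤n = subst (_≤ ⌊log₂ n ⌋) (⌊log₂[2^n]⌋≡n 1) (⌊log₂⌋-mono-≤ 2≤n)

3*[7+t]≤m+21*⌊log₂[7+t]⌋ : ∀ t {m} → 3 * t ≤ m → 3 * (7 + t) ≤ m + 21 * ⌊log₂ (7 + t) ⌋
3*[7+t]≤m+21*⌊log₂[7+t]⌋ t {m} 3t≤m = begin
  3 * (7 + t)                  ≡⟨ *-distribˡ-+ 3 7 t ⟩
  21 + 3 * t                   ≡⟨ +-comm 21 (3 * t) ⟩
  3 * t + 21 * 1               ≤⟨ +-mono-≤ 3t≤m (*-monoʳ-≤ 21 (1≤⌊log₂⌋ (7 + t) (s≤s (s≤s z≤n)))) ⟩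
  m + 21 * ⌊log₂ (7 + t) ⌋     ∎
  where open ≤-Reasoning

rMinMaxLowerBound : ∀ t → RMinMaxLowerBound 21 (7 + t)
rMinMaxLowerBound t enc dec correct =
  map₂ (3*[7+t]≤m+21*⌊log₂[7+t]⌋ t) (encoding-long {6 + t} {3 * t} (paths-outnumber t) enc dec correct)

theorem2 : ∃[ c ] ∃[ N ] ∀ (n : ℕ) → N ≤ n →
             (enc : Array n → List Bool) →
             (dec : List Bool → Fin n → Fin n → ℕ × ℕ) →
             (∀ (A : Array n) (i j : Fin n) → toℕ i ≤ toℕ j →
                dec (enc A) i j ≡ RMinMax A i j) →
             ∃[ A ] 3 * n ≤ length (enc A) + c * ⌊log₂ n ⌋
theorem2 = 21 , 7 , bound
  where
    bound : ∀ n → 7 ≤ n → RMinMaxLowerBound 21 n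
    bound n 7≤n with m≤n⇒∃[o]m+o≡n 7≤n
    ... | t , refl = rMinMaxLowerBound t
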